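{- Let $V$ be a finite set, $k\ge1$, $E=[k]\times V$, and for $S\subseteq E$ let $S_i=\{v:(i,v)\in S\}$. If $\mathcal{F}$ is the set of bases of a matroid $\mathcal{M}=(V,\mathcal{I})$, then $\mathcal{H}=\{S\subseteq E: S_1,\dots,S_k \text{ pairwise disjoint and } S_1\cup\cdots\cup S_k\in\mathcal{F}\}$ is the set of bases of some matroid $\mathcal{M}'=(E,\mathcal{I}')$. -}

module Defs where

open import Data.Nat using (ℕ; _<_)
open import Data.Bool using (Bool; false; _∨_; T)
open import Data.Bool.Properties using (T?)
open import Data.Bool.ListAction using (any)
open import Data.Fin using (Fin; _≟_)
open import Data.List using (List; length; filter; allFin; cartesianProduct)
open import Data.Product using (_×_; _,_; ∃-syntax)
open import Data.Product.Properties using (≡-dec)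
open import Function.Bundles using (_⇔_)
open import Relation.Nullary using (¬_; Dec; does)
open import Relation.Binary.PropositionalEquality using (_≡_)

-- A finite ground set: a type, a concrete duplicate-free enumeration of all
-- its elements, and decidable equality.
record Ground : Set₁ where
  field
    Carrier : Set
    elems   : List Carrier
    _≟ₓ_    : (x y : Carrier) → Dec (x ≡ y)
open Ground public

finG : ℕ → Ground
finG n = record { Carrier = Fin n ; elems = allFin n ; _≟ₓ_ = _≟_ }

-- E = [k] × V, V = Fin n   (index i ∈ Fin k stands for i+1 ∈ [k])
prodG : ℕ → ℕ → Ground
prodG k n = record
  { Carrier = Fin k × Fin n
  ; elems   = cartesianProduct (allFin k) (allFin n)
  ; _≟ₓ_    = ≡-dec _≟_ _≟_ }

Subset : Set → Set
Subset X = X → Bool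

_∈ₛ_ : {X : Set} → X → Subset X → Set
x ∈ₛ S = T (S x)

_⊆ₛ_ : {X : Set} → Subset X → Subset X → Set
A ⊆ₛ B = ∀ x → x ∈ₛ A → x ∈ₛ B

_≐_ : {X : Set} → Subset X → Subset X → Set
A ≐ B = ∀ x → A x ≡ B x

∅ₛ : {X : Set} → Subset X
∅ₛ _ = false

insertₛ : (G : Ground) → Carrier G → Subset (Carrier G) → Subset (Carrier G)
insertₛ G y A x = does (_≟ₓ_ G x y) ∨ A x

card : (G : Ground) → Subset (Carrier G) → ℕ
card G A = length (filter (λ x → T? (A x)) (elems G))

-- Matroid (G, 𝓘) via the independent-set axioms (𝓘 is a family of subsets;
-- `ext` just says it is a family of *sets*, i.e. respects extensional equality).
record IsMatroid (G : Ground) (𝓘 : Subset (Carrier G) → Set) : Set where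
  field
    ext        : ∀ {A B} → A ≐ B → 𝓘 A → 𝓘 B
    empty      : 𝓘 ∅ₛ
    hereditary : ∀ {A B} → A ⊆ₛ B → 𝓘 B → 𝓘 A
    exchange   : ∀ {A B} → 𝓘 A → 𝓘 B → card G A < card G B →
                 ∃[ x ] (x ∈ₛ B × ¬ (x ∈ₛ A) × 𝓘 (insertₛ G x A))

IsBasis : (G : Ground) → (Subset (Carrier G) → Set) → Subset (Carrier G) → Set
IsBasis G 𝓘 B = 𝓘 B × (∀ A → 𝓘 A → B ⊆ₛ A → A ⊆ₛ B)

BasesOf : (G : Ground) → (Subset (Carrier G) → Set) → (Subset (Carrier G) → Set) → Set
BasesOf G 𝓘 𝓕 = ∀ B → 𝓕 B ⇔ IsBasis G 𝓘 B

slice : {k n : ℕ} → Subset (Fin k × Fin n) → Fin k → Subset (Fin n)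
slice S i v = S (i , v)

PairwiseDisjoint : {k n : ℕ} → Subset (Fin k × Fin n) → Set
PairwiseDisjoint S = ∀ i j v → ¬ (i ≡ j) → v ∈ₛ slice S i → ¬ (v ∈ₛ slice S j)

bigUnion : {k n : ℕ} → Subset (Fin k × Fin n) → Subset (Fin n)
bigUnion {k} S v = any (λ i → S (i , v)) (allFin k)

𝓗 : {k n : ℕ} → (Subset (Fin n) → Set) → Subset (Fin k × Fin n) → Set
𝓗 𝓕 S = PairwiseDisjoint S × 𝓕 (bigUnion S)

-- Given a matroid (V, 𝓘) and k ≥ 1, call S ⊆ [k] × V *lifted-independent*
-- when its slices S_1, …, S_k are pairwise disjoint and their union is
-- independent in 𝓘.
--
-- The whole argument rests on one counting fact: for an S with pairwise
-- disjoint slices, |S| = |S_1 ∪ ⋯ ∪ S_k|.  With it, the exchange axiom on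
-- [k] × V is inherited from the exchange axiom on V: an element v added to
-- the union is added back to S in some slice containing it.
module Submission where

open import Defs
open import Data.Nat using (ℕ; _≥_; _<_; suc; _+_)
open import Data.Nat.Properties using (+-suc)
open import Data.Fin using (Fin; zero) renaming (_≟_ to _≟ᶠ_)
open import Data.Product using (_×_; ∃-syntax; _,_; proj₂)
open import Data.Sum using (_⊎_; inj₁; inj₂)
open import Data.Bool using (Bool; true; false; _∨_; T)
open import Data.Bool.Properties using (T?)
open import Data.Bool.ListAction using (any)
open import Data.Unit using (tt)
open import Data.Empty using (⊥-elim)
open import Data.List using (List; []; _∷_; _++_; map; length; filter; allFin; cartesianProduct)
open import Data.List.Properties using (filter-++; length-++)
open import Data.List.Relation.Unary.All using (lookupAny)
open import Data.List.Relation.Unary.Any using (satisfied)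
open import Data.List.Relation.Unary.Any.Properties using (any⁺; any⁻)
open import Data.List.Relation.Unary.AllPairs using (_∷_)
open import Data.List.Relation.Unary.Unique.Propositional using (Unique)
open import Data.List.Relation.Unary.Unique.Propositional.Properties using (allFin⁺)
open import Data.List.Membership.Propositional using (lose)
open import Data.List.Membership.Propositional.Properties using (∈-allFin)
open import Function.Bundles using (mk⇔; Equivalence)
open import Relation.Nullary using (¬_; yes; no)
open import Relation.Binary.PropositionalEquality

count : {X : Set} → (X → Bool) → List X → ℕ
count p xs = length (filter (λ x → T? (p x)) xs)

count-++ : {X : Set} (p : X → Bool) (xs ys : List X) →
           count p (xs ++ ys) ≡ count p xs + count p ys
count-++ p xs ys = begin
  length (filter (λ x → T? (p x)) (xs ++ ys))
    ≡⟨ cong length (filter-++ (λ x → T? (p x)) xs ys) ⟩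
  length (filter (λ x → T? (p x)) xs ++ filter (λ x → T? (p x)) ys)
    ≡⟨ length-++ (filter (λ x → T? (p x)) xs) ⟩
  count p xs + count p ys ∎
  where open ≡-Reasoning

count-map : {X Y : Set} (p : X → Bool) (g : Y → X) (ys : List Y) →
            count p (map g ys) ≡ count (λ y → p (g y)) ys
count-map p g [] = refl
count-map p g (y ∷ ys) with p (g y)
... | true  = cong suc (count-map p g ys)
... | false = count-map p g ys

count-false : {X : Set} (xs : List X) → count (λ _ → false) xs ≡ 0
count-false []       = refl
count-false (x ∷ xs) = count-false xs

count-∨ : {X : Set} (p q : X → Bool) → (∀ x → T (p x) → ¬ T (q x)) → (xs : List X) →
          count (λ x → p x ∨ q x) xs ≡ count p xs + count q xs
count-∨ p q disj [] = refl
count-∨ p q disj (x ∷ xs) with p x in px | q x in qx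
... | true  | true  = ⊥-elim (disj x (subst T (sym px) tt) (subst T (sym qx) tt))
... | true  | false = cong suc (count-∨ p q disj xs)
... | false | true  = trans (cong suc (count-∨ p q disj xs)) (sym (+-suc (count p xs) (count q xs)))
... | false | false = count-∨ p q disj xs

module _ (G : Ground) where

  insert-elim : ∀ y A x → x ∈ₛ insertₛ G y A → x ≡ y ⊎ x ∈ₛ A
  insert-elim y A x x∈ with _≟ₓ_ G x y
  ... | yes x≡y = inj₁ x≡y
  ... | no  _   = inj₂ x∈

  insert-new : ∀ y A → y ∈ₛ insertₛ G y A
  insert-new y A with _≟ₓ_ G y y
  ... | yes _   = tt
  ... | no  y≢y = ⊥-elim (y≢y refl)

  insert-old : ∀ y A → A ⊆ₛ insertₛ G y A
  insert-old y A x x∈A with _≟ₓ_ G x y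
  ... | yes _ = tt
  ... | no  _ = x∈A

  insert-⊆ : ∀ {y A B} → A ⊆ₛ B → y ∈ₛ B → insertₛ G y A ⊆ₛ B
  insert-⊆ {y} {A} A⊆B y∈B x x∈ with insert-elim y A x x∈
  ... | inj₁ refl = y∈B
  ... | inj₂ x∈A  = A⊆B x x∈A

module Slices (k n : ℕ) where

  private
    E = prodG k n
    V = finG n

  ∪-intro : ∀ (S : Subset (Fin k × Fin n)) i v → (i , v) ∈ₛ S → v ∈ₛ bigUnion S
  ∪-intro S i v i,v∈S = any⁺ (λ j → S (j , v)) (lose (∈-allFin i) i,v∈S)

  ∪-elim : ∀ (S : Subset (Fin k × Fin n)) v → v ∈ₛ bigUnion S → ∃[ i ] ((i , v) ∈ₛ S)
  ∪-elim S v v∈∪ = satisfied (any⁻ (λ j → S (j , v)) (allFin k) v∈∪)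

  ∪-mono : ∀ {A B : Subset (Fin k × Fin n)} → A ⊆ₛ B → bigUnion A ⊆ₛ bigUnion B
  ∪-mono {A} {B} A⊆B v v∈∪A with ∪-elim A v v∈∪A
  ... | i , i,v∈A = ∪-intro B i v (A⊆B (i , v) i,v∈A)

  ∪-insert : ∀ (S : Subset (Fin k × Fin n)) i v → bigUnion (insertₛ E (i , v) S) ⊆ₛ insertₛ V v (bigUnion S)
  ∪-insert S i v w w∈ with ∪-elim (insertₛ E (i , v) S) w w∈
  ... | j , j,w∈ with insert-elim E (i , v) S (j , w) j,w∈
  ...   | inj₁ refl  = insert-new V v (bigUnion S)
  ...   | inj₂ j,w∈S = insert-old V v (bigUnion S) w (∪-intro S j w j,w∈S)

  disjoint-⊆ : ∀ {A B : Subset (Fin k × Fin n)} → A ⊆ₛ B → PairwiseDisjoint B → PairwiseDisjoint A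
  disjoint-⊆ A⊆B disjB i j v i≢j v∈Aᵢ v∈Aⱼ = disjB i j v i≢j (A⊆B (i , v) v∈Aᵢ) (A⊆B (j , v) v∈Aⱼ)

  disjoint-insert : ∀ (S : Subset (Fin k × Fin n)) i v → ¬ (v ∈ₛ bigUnion S) → PairwiseDisjoint S →
                    PairwiseDisjoint (insertₛ E (i , v) S)
  disjoint-insert S i v v∉∪ disjS j j′ w j≢j′ w∈ w∈′
    with insert-elim E (i , v) S (j , w) w∈ | insert-elim E (i , v) S (j′ , w) w∈′
  ... | inj₁ refl | inj₁ refl = j≢j′ refl
  ... | inj₁ refl | inj₂ w∈S′ = v∉∪ (∪-intro S j′ w w∈S′)
  ... | inj₂ w∈S  | inj₁ refl = v∉∪ (∪-intro S j w w∈S)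
  ... | inj₂ w∈S  | inj₂ w∈S′ = disjS j j′ w j≢j′ w∈S w∈S′

  count-slices : ∀ (S : Subset (Fin k × Fin n)) → PairwiseDisjoint S → (is : List (Fin k)) → Unique is →
                 count S (cartesianProduct is (allFin n))
                   ≡ count (λ v → any (λ i → S (i , v)) is) (allFin n)
  count-slices S disjS [] _ = sym (count-false (allFin n))
  count-slices S disjS (i ∷ is) (i∉is ∷ uniq) = begin
    count S (map (i ,_) (allFin n) ++ cartesianProduct is (allFin n))
      ≡⟨ count-++ S (map (i ,_) (allFin n)) _ ⟩
    count S (map (i ,_) (allFin n)) + count S (cartesianProduct is (allFin n))
      ≡⟨ cong₂ _+_ (count-map S (i ,_) (allFin n)) (count-slices S disjS is uniq) ⟩
    count (slice S i) (allFin n) + count (λ v → any (λ j → S (j , v)) is) (allFin n)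
      ≡⟨ count-∨ (slice S i) (λ v → any (λ j → S (j , v)) is) apart (allFin n) ⟨
    count (λ v → any (λ j → S (j , v)) (i ∷ is)) (allFin n) ∎
    where
    open ≡-Reasoning
    apart : ∀ v → v ∈ₛ slice S i → ¬ T (any (λ j → S (j , v)) is)
    apart v v∈Sᵢ v∈∪ with lookupAny i∉is (any⁻ (λ j → S (j , v)) is v∈∪)
    ... | i≢j , v∈Sⱼ = disjS i _ v i≢j v∈Sᵢ v∈Sⱼ

  card-∪ : ∀ (S : Subset (Fin k × Fin n)) → PairwiseDisjoint S → card E S ≡ card V (bigUnion S)
  card-∪ S disjS = count-slices S disjS (allFin k) (allFin⁺ k)

module Lift {n : ℕ} (k : ℕ) (𝓘 : Subset (Fin n) → Set) (M : IsMatroid (finG n) 𝓘) where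

  open IsMatroid M
  open Slices k n

  private
    E = prodG k n
    V = finG n

  𝓘ᵏ : Subset (Fin k × Fin n) → Set
  𝓘ᵏ S = PairwiseDisjoint S × 𝓘 (bigUnion S)

  hereditaryᵏ : ∀ {A B} → A ⊆ₛ B → 𝓘ᵏ B → 𝓘ᵏ A
  hereditaryᵏ A⊆B (disjB , indB) = disjoint-⊆ A⊆B disjB , hereditary (∪-mono A⊆B) indB

  extᵏ : ∀ {A B} → A ≐ B → 𝓘ᵏ A → 𝓘ᵏ B
  extᵏ A≐B = hereditaryᵏ (λ x x∈B → subst T (sym (A≐B x)) x∈B)

  emptyᵏ : 𝓘ᵏ ∅ₛ
  emptyᵏ = (λ _ _ _ _ ()) , hereditary (λ v v∈∪ → ⊥-elim (proj₂ (∪-elim ∅ₛ v v∈∪))) empty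

  insertᵏ : ∀ {S} i v → ¬ (v ∈ₛ bigUnion S) → 𝓘ᵏ S → 𝓘 (insertₛ V v (bigUnion S)) →
            𝓘ᵏ (insertₛ E (i , v) S)
  insertᵏ {S} i v v∉∪ (disjS , _) ind+v =
    disjoint-insert S i v v∉∪ disjS , hereditary (∪-insert S i v) ind+v

  -- Exchange: apply exchange to the unions (same cardinalities by card-∪),
  -- then put the new point v back into a slice of B that contains it.
  exchangeᵏ : ∀ {A B} → 𝓘ᵏ A → 𝓘ᵏ B → card E A < card E B →
              ∃[ x ] (x ∈ₛ B × ¬ (x ∈ₛ A) × 𝓘ᵏ (insertₛ E x A))
  exchangeᵏ {A} {B} indA@(disjA , ∪A) (disjB , ∪B) |A|<|B|
    with exchange ∪A ∪B (subst₂ _<_ (card-∪ A disjA) (card-∪ B disjB) |A|<|B|)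
  ... | v , v∈∪B , v∉∪A , ind+v with ∪-elim B v v∈∪B
  ...   | i , i,v∈B = (i , v) , i,v∈B , (λ i,v∈A → v∉∪A (∪-intro A i v i,v∈A)) , insertᵏ i v v∉∪A indA ind+v

  matroidᵏ : IsMatroid E 𝓘ᵏ
  matroidᵏ = record { ext = extᵏ ; empty = emptyᵏ ; hereditary = hereditaryᵏ ; exchange = exchangeᵏ }

  -- A disjoint S whose union is a basis of 𝓘 is a basis of 𝓘ᵏ: a larger
  -- lifted-independent A has the same union (by maximality), so each of its
  -- points lies in some slice of S, and disjointness of A pins down the slice.
  basis-from-∪ : ∀ (S : Subset (Fin k × Fin n)) → PairwiseDisjoint S → IsBasis V 𝓘 (bigUnion S) → IsBasis E 𝓘ᵏ S
  basis-from-∪ S disjS (∪S , maxS) = (disjS , ∪S) , maximal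
    where
    maximal : ∀ A → 𝓘ᵏ A → S ⊆ₛ A → A ⊆ₛ S
    maximal A (disjA , ∪A) S⊆A (i , v) i,v∈A
      with ∪-elim S v (maxS (bigUnion A) ∪A (∪-mono S⊆A) v (∪-intro A i v i,v∈A))
    ... | j , j,v∈S with i ≟ᶠ j
    ...   | yes refl = j,v∈S
    ...   | no  i≢j  = ⊥-elim (disjA i j v i≢j i,v∈A (S⊆A (j , v) j,v∈S))

  -- Conversely the union of a basis of 𝓘ᵏ is a basis of 𝓘: a point v of a
  -- larger independent set missing from ∪S could be added to slice i₀ of S.
  ∪-of-basis : Fin k → ∀ (S : Subset (Fin k × Fin n)) → IsBasis E 𝓘ᵏ S → IsBasis V 𝓘 (bigUnion S)
  ∪-of-basis i₀ S (indS@(_ , ∪S) , maxS) = ∪S , maximal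
    where
    maximal : ∀ A → 𝓘 A → bigUnion S ⊆ₛ A → A ⊆ₛ bigUnion S
    maximal A indA ∪S⊆A v v∈A with T? (bigUnion S v)
    ... | yes v∈∪S = v∈∪S
    ... | no  v∉∪S = ⊥-elim (v∉∪S (∪-intro S i₀ v i₀,v∈S))
      where
      i₀,v∈S : (i₀ , v) ∈ₛ S
      i₀,v∈S = maxS (insertₛ E (i₀ , v) S)
                    (insertᵏ i₀ v v∉∪S indS (hereditary (insert-⊆ V ∪S⊆A v∈A) indA))
                    (insert-old E (i₀ , v) S) (i₀ , v) (insert-new E (i₀ , v) S)

  basesᵏ : Fin k → (𝓕 : Subset (Fin n) → Set) → BasesOf V 𝓘 𝓕 → BasesOf E 𝓘ᵏ (𝓗 {k} {n} 𝓕)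
  basesᵏ i₀ 𝓕 bases S = mk⇔
    (λ (disjS , 𝓕∪S) → basis-from-∪ S disjS (Equivalence.to (bases (bigUnion S)) 𝓕∪S))
    (λ basisS@((disjS , _) , _) → disjS , Equivalence.from (bases (bigUnion S)) (∪-of-basis i₀ S basisS))

corollary3 : (n k : ℕ) → k ≥ 1 →
    (𝓘 : Subset (Fin n) → Set) → IsMatroid (finG n) 𝓘 →
    (𝓕 : Subset (Fin n) → Set) → BasesOf (finG n) 𝓘 𝓕 →
    ∃[ 𝓘' ] (IsMatroid (prodG k n) 𝓘' × BasesOf (prodG k n) 𝓘' (𝓗 {k} {n} 𝓕))
corollary3 n (suc k) _ 𝓘 M 𝓕 bases = 𝓘ᵏ , matroidᵏ , basesᵏ zero 𝓕 bases
  where open Lift (suc k) 𝓘 M
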